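{- Let $H$ be a graph and $v\in V(H)$. Then $v$ is detectable in $H$ if and only if at least one of the following holds: (1) $v$ is happy in $H$; (2) $v$ has degree $1$.
   Context: Graphs are finite and simple. For a graph $G$, $M(G)$ is the induced subgraph of $G$ on its non-isolated vertices; $G-v$ is $G$ with vertex $v$ deleted; $\deg_{G}(v)$ is the degree of $v$ in $G$. A non-isolated vertex $v$ of $H$ is obscure in $H$ if there exist distinct non-isolated vertices $v_1,v_2$ of $H$ with $\deg_{H-v_1}(v_2)>0$ and an induced subgraph $H'$ of $H-v_1-v_2$ with $M(H-v)\cong H'$. A non-isolated vertex is detectable in $H$ if it is not obscure in $H$ (isolated vertices are never detectable). A non-isolated vertex is happy in $H$ if all its neighbours have degree at least $2$. -}

module Defs where

open import Data.Nat using (ℕ; zero; suc; _<_; _≤_; _<ᵇ_)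
open import Data.Bool using (Bool; true; false; _∧_; not; if_then_else_)
open import Data.Fin using (Fin; _≟_)
open import Data.List using (List; map; allFin)
open import Data.Nat.ListAction using (sum)
open import Data.Product using (Σ; ∃; ∃-syntax; _×_; proj₁; proj₂)
open import Relation.Nullary using (¬_)
open import Relation.Nullary.Decidable using (⌊_⌋)
open import Relation.Binary.PropositionalEquality using (_≡_; _≢_)
open import Function.Bundles using (_↔_; Inverse)

record Graph : Set where
  field
    n      : ℕ
    adj    : Fin n → Fin n → Bool
    sym    : ∀ u v → adj u v ≡ adj v u
    irrefl : ∀ v → adj v v ≡ false

open Graph public

-- Vertex subsets of G (as Boolean predicates); an induced subgraph of G
-- is G[S] for a vertex subset S.
VSet : Graph → Set
VSet G = Fin (n G) → Bool

full : (G : Graph) → VSet G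
full G _ = true

Elem : (G : Graph) → VSet G → Set
Elem G S = Σ (Fin (n G)) (λ u → S u ≡ true)

_⊆ᵥ_ : {G : Graph} → VSet G → VSet G → Set
_⊆ᵥ_ {G} S T = ∀ (u : Fin (n G)) → S u ≡ true → T u ≡ true

degIn : (G : Graph) → VSet G → Fin (n G) → ℕ
degIn G S v = sum (map (λ u → if S u ∧ adj G v u then 1 else 0) (allFin (n G)))

deg : (G : Graph) → Fin (n G) → ℕ
deg G v = degIn G (full G) v

minus : (G : Graph) → VSet G → Fin (n G) → VSet G
minus G S v u = S u ∧ not ⌊ u ≟ v ⌋

M : (G : Graph) → VSet G → VSet G
M G S u = S u ∧ (0 <ᵇ degIn G S u)

-- G[S] ≅ G[T]: a bijection between vertex sets preserving adjacency
-- (in both directions, since adjacency values are equal)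
Iso : (G : Graph) → VSet G → VSet G → Set
Iso G S T = Σ (Elem G S ↔ Elem G T) λ φ →
  ∀ (x y : Elem G S) →
    adj G (proj₁ x) (proj₁ y) ≡ adj G (proj₁ (Inverse.to φ x)) (proj₁ (Inverse.to φ y))

NonIsolated : (G : Graph) → Fin (n G) → Set
NonIsolated G v = 0 < deg G v

Obscure : (H : Graph) → Fin (n H) → Set
Obscure H v =
  NonIsolated H v ×
  ∃[ v₁ ] ∃[ v₂ ]
    (NonIsolated H v₁ × NonIsolated H v₂ × v₁ ≢ v₂ ×
     0 < degIn H (minus H (full H) v₁) v₂ ×
     ∃[ T ] (_⊆ᵥ_ {H} T (minus H (minus H (full H) v₁) v₂) ×
             Iso H (M H (minus H (full H) v)) T))

Detectable : (H : Graph) → Fin (n H) → Set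
Detectable H v = NonIsolated H v × ¬ Obscure H v

Happy : (H : Graph) → Fin (n H) → Set
Happy H v = NonIsolated H v × (∀ u → adj H v u ≡ true → 2 ≤ deg H u)

{-# OPTIONS --safe #-}
-- If v has a neighbour u of degree 1 and another neighbour, then v is obscure with v₁ = u,
-- v₂ = v and H' = M(H − v): deleting v isolates u, so M(H − v) already lies in H − u − v.
-- Conversely, an isomorphism M(H − v) ≅ H' ⊆ H − v₁ − v₂ yields an injection of a finite set
-- into a proper subset of itself. If v is happy, deleting v isolates no other vertex, so
-- sending v to v₂ and every other non-isolated vertex to its image injects the non-isolated
-- vertices of H into those different from v₁. If v has degree 1, the same is done with
-- ordered edges: the two orientations of the edge at v go to v₂x and xv₂, where x ≠ v₁ is a
-- neighbour of v₂, and the edges leaving v₁ are missed.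
module Submission where

open import Axiom.UniquenessOfIdentityProofs using (module Decidable⇒UIP)
open import Data.Bool using (Bool; true; false; _∧_; not; if_then_else_)
open import Data.Bool.Properties using (∧-identityʳ)
import Data.Bool.Properties as Bool
open import Data.Empty using (⊥-elim)
open import Data.Fin using (Fin; zero; suc; punchOut)
open import Data.Fin.Properties using (_≟_; punchOut-injective; injective⇒≤; *↔×; any?)
open import Data.List as List using (allFin)
open import Data.List.Properties using (map-tabulate; map-cong)
open import Data.Nat using (ℕ; suc; _+_; _<_; _≤_; z≤n; s≤s; _<ᵇ_; _<?_)
open import Data.Nat.ListAction using (sum)
open import Data.Nat.Properties
  using (1+n≰n; +-suc; ≤-trans; m≤n+m; ≤-pred; ≤-reflexive; ≤∧≢⇒<; ≰⇒>; _≤?_)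
import Data.Nat.Properties as ℕ
open import Data.Product using (∃-syntax; _×_; _,_; proj₁; proj₂)
open import Data.Sum using (_⊎_; inj₁; inj₂)
open import Function using (_∘_; id; Injective)
open import Function.Bundles using (_↔_; _⇔_; Inverse; Injection; mk⇔)
open import Function.Construct.Identity using (↔-id)
open import Function.Construct.Symmetry using (↔-sym)
open import Function.Properties.Inverse using (↔⇒↣)
open import Level using (0ℓ)
open import Relation.Binary.PropositionalEquality
  using (_≡_; _≢_; refl; sym; trans; cong; cong₂; subst)
open import Relation.Nullary using (¬_; yes; no; _×-dec_)
open import Relation.Nullary.Decidable using (⌊_⌋)
open import Relation.Unary using (Pred; Decidable)

open import Defs hiding (sym)

missesPoint⇒¬injective : ∀ {n} {f : Fin n → Fin n} i → (∀ j → f j ≢ i) → ¬ Injective _≡_ _≡_ f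
missesPoint⇒¬injective {suc n} i f≢i f-injective = 1+n≰n (injective⇒≤ punchOut-f-injective)
  where
  punchOut-f-injective : Injective _≡_ _≡_ (λ j → punchOut (f≢i j ∘ sym))
  punchOut-f-injective {j} {k} eq = f-injective (punchOut-injective (f≢i j ∘ sym) (f≢i k ∘ sym) eq)

record InjectionAvoiding {A : Set} (P : Pred A 0ℓ) (a : A) : Set where
  field
    map       : ∀ x → P x → A
    map-∈     : ∀ x p → P (map x p)
    map-≢     : ∀ x p → map x p ≢ a
    injective : ∀ {x y} p q → map x p ≡ map y q → x ≡ y

module _ {A : Set} {n : ℕ} (A↔Fin : A ↔ Fin n) where

  private
    to-injective = Injection.injective (↔⇒↣ A↔Fin)
    from-injective = Injection.injective (↔⇒↣ (↔-sym A↔Fin))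
  open Inverse A↔Fin using (to; from)

  finite-missesPoint⇒¬injective : {g : A → A} (a : A) → (∀ x → g x ≢ a) → ¬ Injective _≡_ _≡_ g
  finite-missesPoint⇒¬injective {g} a g≢a g-injective =
    missesPoint⇒¬injective {f = to ∘ g ∘ from} (to a)
      (λ j → g≢a (from j) ∘ to-injective)
      (from-injective ∘ g-injective ∘ to-injective)

  dedekindFinite : {P : Pred A 0ℓ} → Decidable P → ∀ {a} → P a → ¬ InjectionAvoiding P a
  dedekindFinite {P} P? {a} a∈P h =
    finite-missesPoint⇒¬injective a extend≢a extend-injective
    where
    open InjectionAvoiding h
    extend : A → A
    extend x with P? x
    ... | yes p = map x p
    ... | no _ = x

    extend≢a : ∀ x → extend x ≢ a
    extend≢a x with P? x
    ... | yes p = map-≢ x p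
    ... | no x∉P = λ x≡a → x∉P (subst P (sym x≡a) a∈P)

    extend-injective : Injective _≡_ _≡_ extend
    extend-injective {x} {y} eq with P? x | P? y
    ... | yes p | yes q = injective p q eq
    ... | yes p | no y∉P = ⊥-elim (y∉P (subst P eq (map-∈ x p)))
    ... | no x∉P | yes q = ⊥-elim (x∉P (subst P (sym eq) (map-∈ y q)))
    ... | no _ | no _ = eq

-- degIn G S v is count (λ u → S u ∧ adj G v u) and minus G S v is S ∖ v, both definitionally.
count : ∀ {N} → (Fin N → Bool) → ℕ
count {N} P = sum (List.map (λ u → if P u then 1 else 0) (allFin N))

count-suc : ∀ {N} (P : Fin (suc N) → Bool) → count P ≡ (if P zero then 1 else 0) + count (P ∘ suc)
count-suc P = cong (λ xs → (if P zero then 1 else 0) + sum xs)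
  (trans (map-tabulate suc indicator) (sym (map-tabulate id (indicator ∘ suc))))
  where indicator = λ u → if P u then 1 else 0

count-cong : ∀ {N} {P Q : Fin N → Bool} → (∀ x → P x ≡ Q x) → count P ≡ count Q
count-cong {N} P≗Q = cong sum (map-cong (λ x → cong (if_then 1 else 0) (P≗Q x)) (allFin N))

count-pos : ∀ {N} (P : Fin N → Bool) {x} → P x ≡ true → 0 < count P
count-pos P {zero} Px rewrite count-suc P | Px = s≤s z≤n
count-pos P {suc x} Px rewrite count-suc P =
  ≤-trans (count-pos (P ∘ suc) Px) (m≤n+m _ (if P zero then 1 else 0))

count-pos⇒witness : ∀ {N} (P : Fin N → Bool) → 0 < count P → ∃[ x ] P x ≡ true
count-pos⇒witness {suc N} P 0<count with P zero in P0 | count-suc P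
... | true | _ = zero , P0
... | false | eq with count-pos⇒witness (P ∘ suc) (subst (0 <_) eq 0<count)
...   | x , Px = suc x , Px

_∖_ : ∀ {N} → (Fin N → Bool) → Fin N → Fin N → Bool
(P ∖ y) x = P x ∧ not ⌊ x ≟ y ⌋

∈∖⁺ : ∀ {N} {P : Fin N → Bool} {x y} → P x ≡ true → x ≢ y → (P ∖ y) x ≡ true
∈∖⁺ {x = x} {y} Px x≢y with x ≟ y
... | yes x≡y = ⊥-elim (x≢y x≡y)
... | no _ = trans (∧-identityʳ _) Px

∈∖⁻ : ∀ {N} {P : Fin N → Bool} {x y} → (P ∖ y) x ≡ true → P x ≡ true × x ≢ y
∈∖⁻ {P = P} {x} {y} x∈P∖y with P x | x ≟ y
... | true | no x≢y = refl , x≢y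

⌊suc≟suc⌋ : ∀ {N} (x y : Fin N) → ⌊ suc x ≟ suc y ⌋ ≡ ⌊ x ≟ y ⌋
⌊suc≟suc⌋ x y with x ≟ y
... | yes _ = refl
... | no _ = refl

count-remove : ∀ {N} (P : Fin N → Bool) {y} → P y ≡ true → count P ≡ suc (count (P ∖ y))
count-remove P {zero} Py
  rewrite count-suc P | count-suc (P ∖ zero) | Py =
  cong suc (count-cong (λ x → sym (∧-identityʳ (P (suc x)))))
count-remove P {suc y} Py
  rewrite count-suc P | count-suc (P ∖ suc y)
        | ∧-identityʳ (P zero) | count-remove (P ∘ suc) Py
        | count-cong (λ x → cong (λ b → P (suc x) ∧ not b) (⌊suc≟suc⌋ x y)) =
  +-suc (if P zero then 1 else 0) _

count≤1⇒unique : ∀ {N} (P : Fin N → Bool) {y z} → count P ≤ 1 → P y ≡ true → P z ≡ true → z ≡ y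
count≤1⇒unique P {y} {z} count≤1 Py Pz with z ≟ y
... | yes z≡y = z≡y
... | no z≢y = ⊥-elim (1+n≰n (≤-trans 2≤count count≤1))
  where
  2≤count : 2 ≤ count P
  2≤count = subst (2 ≤_) (sym (count-remove P Py)) (s≤s (count-pos (P ∖ y) (∈∖⁺ {P = P} Pz z≢y)))

2≤count⇒other : ∀ {N} (P : Fin N → Bool) {y} → 2 ≤ count P → P y ≡ true → ∃[ z ] z ≢ y × P z ≡ true
2≤count⇒other P {y} 2≤count Py
  with z , z∈P∖y ← count-pos⇒witness (P ∖ y) (≤-pred (subst (2 ≤_) (count-remove P Py) 2≤count))
  with Pz , z≢y ← ∈∖⁻ {P = P} z∈P∖y
  = z , z≢y , Pz

∧-true⁺ : ∀ {a b} → a ≡ true → b ≡ true → a ∧ b ≡ true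
∧-true⁺ refl refl = refl

∧-true⁻ : ∀ {a b} → a ∧ b ≡ true → a ≡ true × b ≡ true
∧-true⁻ {true} {true} refl = refl , refl

0<⇒0<ᵇ : ∀ {k} → 0 < k → (0 <ᵇ k) ≡ true
0<⇒0<ᵇ {suc _} _ = refl

0<ᵇ⇒0< : ∀ {k} → (0 <ᵇ k) ≡ true → 0 < k
0<ᵇ⇒0< {suc _} _ = s≤s z≤n

delete : (G : Graph) → Fin (n G) → VSet G
delete G v = minus G (full G) v

module _ (G : Graph) where

  adj-sym : ∀ {u w} → adj G u w ≡ true → adj G w u ≡ true
  adj-sym {u} {w} uw = trans (Graph.sym G w u) uw

  adj⇒≢ : ∀ {u w} → adj G u w ≡ true → u ≢ w
  adj⇒≢ {u} uw refl with () ← trans (sym (irrefl G u)) uw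

  adj⇒degIn-pos : ∀ {S u w} → S w ≡ true → adj G u w ≡ true → 0 < degIn G S u
  adj⇒degIn-pos {S} {u} Sw uw = count-pos (λ w → S w ∧ adj G u w) (∧-true⁺ Sw uw)

  degIn-pos⇒adj : ∀ {S u} → 0 < degIn G S u → ∃[ w ] S w ≡ true × adj G u w ≡ true
  degIn-pos⇒adj {S} {u} 0<deg with w , Sw∧uw ← count-pos⇒witness (λ w → S w ∧ adj G u w) 0<deg =
    w , ∧-true⁻ Sw∧uw

  ∈M⁺ : ∀ {S u w} → S u ≡ true → S w ≡ true → adj G u w ≡ true → M G S u ≡ true
  ∈M⁺ Su Sw uw = ∧-true⁺ Su (0<⇒0<ᵇ (adj⇒degIn-pos Sw uw))

  ∈M⁻ : ∀ {S u} → M G S u ≡ true → S u ≡ true × ∃[ w ] S w ≡ true × adj G u w ≡ true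
  ∈M⁻ {S} u∈M with Su , 0<deg ← ∧-true⁻ {S _} u∈M = Su , degIn-pos⇒adj (0<ᵇ⇒0< 0<deg)

  M-neighbour : ∀ {S u} → M G S u ≡ true → ∃[ w ] M G S w ≡ true × adj G u w ≡ true
  M-neighbour u∈M with Su , w , Sw , uw ← ∈M⁻ u∈M = w , ∈M⁺ Sw Su (adj-sym uw) , uw

  ∈M-delete⁺ : ∀ {v u w} → u ≢ v → w ≢ v → adj G u w ≡ true → M G (delete G v) u ≡ true
  ∈M-delete⁺ u≢v w≢v uw = ∈M⁺ (∈∖⁺ {P = full G} refl u≢v) (∈∖⁺ {P = full G} refl w≢v) uw

  other-neighbour : ∀ {u v} → NonIsolated G u → (adj G u v ≡ true → 2 ≤ deg G u) →
    ∃[ w ] w ≢ v × adj G u w ≡ true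
  other-neighbour {u} {v} 0<du 2≤du with w , uw ← count-pos⇒witness (adj G u) 0<du with w ≟ v
  ... | no w≢v = w , w≢v , uw
  ... | yes refl = 2≤count⇒other (adj G u) (2≤du uw) uw

elem-≡ : ∀ {G : Graph} {S : VSet G} {x y} {Sx : S x ≡ true} {Sy : S y ≡ true} →
  x ≡ y → _≡_ {A = Elem G S} (x , Sx) (y , Sy)
elem-≡ refl = cong (_ ,_) (≡-irrelevant _ _)
  where open Decidable⇒UIP Bool._≟_

module IsoImage {G : Graph} {S T : VSet G} (iso : Iso G S T) where

  image : ∀ x → S x ≡ true → Fin (n G)
  image x Sx = proj₁ (Inverse.to (proj₁ iso) (x , Sx))

  image∈T : ∀ {x} Sx → T (image x Sx) ≡ true
  image∈T Sx = proj₂ (Inverse.to (proj₁ iso) (_ , Sx))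

  image-adj : ∀ {x y} Sx Sy → adj G x y ≡ adj G (image x Sx) (image y Sy)
  image-adj Sx Sy = proj₂ iso (_ , Sx) (_ , Sy)

  image-injective : ∀ {x y} Sx Sy → image x Sx ≡ image y Sy → x ≡ y
  image-injective Sx Sy eq =
    cong proj₁ (Injection.injective (↔⇒↣ (proj₁ iso)) (elem-≡ {G} {T} eq))

  image-nonIsolated : ∀ {x y} Sx Sy → adj G x y ≡ true → NonIsolated G (image x Sx)
  image-nonIsolated Sx Sy xy = adj⇒degIn-pos G {full G} refl (trans (sym (image-adj Sx Sy)) xy)

module ObscureImage (H : Graph) (v v₁ v₂ : Fin (n H)) {T : VSet H}
  (T⊆ : _⊆ᵥ_ {H} T (minus H (delete H v₁) v₂)) (iso : Iso H (M H (delete H v)) T) where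

  open IsoImage {H} {M H (delete H v)} {T} iso public

  image≢v₁ : ∀ {x} x∈M → image x x∈M ≢ v₁
  image≢v₁ x∈M = proj₂ (∈∖⁻ {P = full H} (proj₁ (∈∖⁻ {P = delete H v₁} (T⊆ _ (image∈T x∈M)))))

  image≢v₂ : ∀ {x} x∈M → image x x∈M ≢ v₂
  image≢v₂ x∈M = proj₂ (∈∖⁻ {P = delete H v₁} (T⊆ _ (image∈T x∈M)))

happy⇒¬obscure : ∀ H {v} → Happy H v → ¬ Obscure H v
happy⇒¬obscure H {v} (_ , happy) (_ , v₁ , v₂ , 0<dv₁ , 0<dv₂ , v₁≢v₂ , _ , T , T⊆ , iso) =
  dedekindFinite (↔-id _) (λ x → 0 <? deg H x) 0<dv₁ shift
  where
  open ObscureImage H v v₁ v₂ T⊆ iso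

  stays-nonIsolated : ∀ {x} → x ≢ v → NonIsolated H x → M H (delete H v) x ≡ true
  stays-nonIsolated x≢v 0<dx with w , w≢v , xw ← other-neighbour H 0<dx (happy _ ∘ adj-sym H) =
    ∈M-delete⁺ H x≢v w≢v xw

  relabel : ∀ x → NonIsolated H x → Fin (n H)
  relabel x 0<dx with x ≟ v
  ... | yes _ = v₂
  ... | no x≢v = image x (stays-nonIsolated x≢v 0<dx)

  relabel-∈ : ∀ x 0<dx → NonIsolated H (relabel x 0<dx)
  relabel-∈ x 0<dx with x ≟ v
  ... | yes _ = 0<dv₂
  ... | no x≢v with w , w∈M , xw ← M-neighbour H (stays-nonIsolated x≢v 0<dx) =
    image-nonIsolated _ w∈M xw

  relabel-≢ : ∀ x 0<dx → relabel x 0<dx ≢ v₁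
  relabel-≢ x 0<dx with x ≟ v
  ... | yes _ = v₁≢v₂ ∘ sym
  ... | no x≢v = image≢v₁ _

  relabel-injective : ∀ {x y} 0<dx 0<dy → relabel x 0<dx ≡ relabel y 0<dy → x ≡ y
  relabel-injective {x} {y} 0<dx 0<dy with x ≟ v | y ≟ v
  ... | yes refl | yes refl = λ _ → refl
  ... | yes _ | no _ = ⊥-elim ∘ image≢v₂ _ ∘ sym
  ... | no _ | yes _ = ⊥-elim ∘ image≢v₂ _
  ... | no _ | no _ = image-injective _ _

  shift : InjectionAvoiding (NonIsolated H) v₁
  shift = record
    { map = relabel ; map-∈ = relabel-∈ ; map-≢ = relabel-≢ ; injective = relabel-injective }

leaf⇒¬obscure : ∀ H {v} → deg H v ≡ 1 → ¬ Obscure H v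
leaf⇒¬obscure H {v} dv≡1 (_ , v₁ , v₂ , 0<dv₁ , _ , v₁≢v₂ , v₂-nbr , T , T⊆ , iso)
  with x , x∈H-v₁ , v₂x ← degIn-pos⇒adj H v₂-nbr
     | y₁ , v₁y₁ ← count-pos⇒witness (adj H v₁) 0<dv₁ =
  dedekindFinite (↔-sym *↔×) (λ (a , b) → adj H a b Bool.≟ true) v₁y₁ shift
  where
  open ObscureImage H v v₁ v₂ T⊆ iso

  x≢v₁ : x ≢ v₁
  x≢v₁ = proj₂ (∈∖⁻ {P = full H} x∈H-v₁)

  x≢v₂ : x ≢ v₂
  x≢v₂ = adj⇒≢ H v₂x ∘ sym

  unique-neighbour : ∀ {b b′} → adj H v b ≡ true → adj H v b′ ≡ true → b ≡ b′
  unique-neighbour vb vb′ = count≤1⇒unique (adj H v) (≤-reflexive dv≡1) vb′ vb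

  Edge : Pred (Fin (n H) × Fin (n H)) 0ℓ
  Edge (a , b) = adj H a b ≡ true

  relabel : ∀ e → Edge e → Fin (n H) × Fin (n H)
  relabel (a , b) ab with a ≟ v | b ≟ v
  ... | yes _ | _ = v₂ , x
  ... | no _ | yes _ = x , v₂
  ... | no a≢v | no b≢v =
    image a (∈M-delete⁺ H a≢v b≢v ab) , image b (∈M-delete⁺ H b≢v a≢v (adj-sym H ab))

  relabel-∈ : ∀ e p → Edge (relabel e p)
  relabel-∈ (a , b) ab with a ≟ v | b ≟ v
  ... | yes _ | _ = v₂x
  ... | no _ | yes _ = adj-sym H v₂x
  ... | no _ | no _ = trans (sym (image-adj _ _)) ab

  relabel-≢ : ∀ e p → relabel e p ≢ (v₁ , y₁)
  relabel-≢ (a , b) ab with a ≟ v | b ≟ v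
  ... | yes _ | _ = v₁≢v₂ ∘ sym ∘ cong proj₁
  ... | no _ | yes _ = x≢v₁ ∘ cong proj₁
  ... | no _ | no _ = image≢v₁ _ ∘ cong proj₁

  -- v₂ occurs in an image edge only as the image of v: images avoid v₂, and x ≢ v₂.
  relabel-injective : ∀ {e e′} p q → relabel e p ≡ relabel e′ q → e ≡ e′
  relabel-injective {a , b} {a′ , b′} ab a′b′ with a ≟ v | b ≟ v | a′ ≟ v | b′ ≟ v
  ... | yes refl | _ | yes refl | _ = λ _ → cong (v ,_) (unique-neighbour ab a′b′)
  ... | yes _ | _ | no _ | yes _ = ⊥-elim ∘ x≢v₂ ∘ sym ∘ cong proj₁
  ... | yes _ | _ | no _ | no _ = ⊥-elim ∘ image≢v₂ _ ∘ sym ∘ cong proj₁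
  ... | no _ | yes _ | yes _ | _ = ⊥-elim ∘ x≢v₂ ∘ cong proj₁
  ... | no _ | yes refl | no _ | yes refl =
    λ _ → cong (_, v) (unique-neighbour (adj-sym H ab) (adj-sym H a′b′))
  ... | no _ | yes _ | no _ | no _ = ⊥-elim ∘ image≢v₂ _ ∘ sym ∘ cong proj₂
  ... | no _ | no _ | yes _ | _ = ⊥-elim ∘ image≢v₂ _ ∘ cong proj₁
  ... | no _ | no _ | no _ | yes _ = ⊥-elim ∘ image≢v₂ _ ∘ cong proj₂
  ... | no _ | no _ | no _ | no _ = λ eq →
    cong₂ _,_ (image-injective _ _ (cong proj₁ eq)) (image-injective _ _ (cong proj₂ eq))

  shift : InjectionAvoiding Edge (v₁ , y₁)
  shift = record
    { map = relabel ; map-∈ = relabel-∈ ; map-≢ = relabel-≢ ; injective = relabel-injective }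

leafNeighbour⇒obscure : ∀ H {v u} → 2 ≤ deg H v → adj H v u ≡ true → deg H u ≤ 1 → Obscure H v
leafNeighbour⇒obscure H {v} {u} 2≤dv vu du≤1 with w , w≢u , vw ← 2≤count⇒other (adj H v) 2≤dv vu =
  0<dv , u , v , adj⇒degIn-pos H refl (adj-sym H vu) , 0<dv , adj⇒≢ H (adj-sym H vu) ,
  adj⇒degIn-pos H (∈∖⁺ {P = full H} refl w≢u) vw ,
  M H (delete H v) , M⊆ , ↔-id _ , λ _ _ → refl
  where
  0<dv : NonIsolated H v
  0<dv = ≤-trans (s≤s z≤n) 2≤dv

  M⊆ : _⊆ᵥ_ {H} (M H (delete H v)) (minus H (delete H u) v)
  M⊆ t t∈M with t∈H-v , s , s∈H-v , ts ← ∈M⁻ H t∈M =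
    ∈∖⁺ {P = delete H u} (∈∖⁺ {P = full H} refl t≢u) t≢v
    where
    t≢v : t ≢ v
    t≢v = proj₂ (∈∖⁻ {P = full H} t∈H-v)

    t≢u : t ≢ u
    t≢u refl = proj₂ (∈∖⁻ {P = full H} s∈H-v) (count≤1⇒unique (adj H t) du≤1 (adj-sym H vu) ts)

detectable⇒happy⊎leaf : ∀ H {v} → Detectable H v → Happy H v ⊎ deg H v ≡ 1
detectable⇒happy⊎leaf H {v} (0<dv , ¬obscure) with deg H v ℕ.≟ 1
... | yes dv≡1 = inj₂ dv≡1
... | no dv≢1 with any? (λ u → (adj H v u Bool.≟ true) ×-dec (deg H u ≤? 1))
...   | yes (u , vu , du≤1) =
  ⊥-elim (¬obscure (leafNeighbour⇒obscure H (≤∧≢⇒< 0<dv (dv≢1 ∘ sym)) vu du≤1))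
...   | no ¬leafNeighbour = inj₁ (0<dv , λ u vu → ≰⇒> (¬leafNeighbour ∘ (u ,_) ∘ (vu ,_)))

happy⊎leaf⇒detectable : ∀ H {v} → Happy H v ⊎ deg H v ≡ 1 → Detectable H v
happy⊎leaf⇒detectable H (inj₁ happy) = proj₁ happy , happy⇒¬obscure H happy
happy⊎leaf⇒detectable H (inj₂ dv≡1) = subst (0 <_) (sym dv≡1) (s≤s z≤n) , leaf⇒¬obscure H dv≡1

claim6p4 : (H : Graph) (v : Fin (n H)) →
    Detectable H v ⇔ (Happy H v ⊎ deg H v ≡ 1)
claim6p4 H v = mk⇔ (detectable⇒happy⊎leaf H) (happy⊎leaf⇒detectable H)
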